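{- Let $s,t$ be real numbers with $s\neq0$, $t\neq0$. For every positive integer $n$, \[ \genfrac{\{}{\}}{0pt}{}{n+2}{2}_{s,t}^2-t^2\genfrac{\{}{\}}{0pt}{}{n+1}{2}_{s,t}^2=\left(\frac{\{n+2\}_{s,t}+t\{n\}_{s,t}}{s}\right)\{n+1\}_{s,t}^3. \]
   Context: The generalized Fibonacci polynomials $\{n\}_{s,t}$ are defined by $\{0\}_{s,t}=0$, $\{1\}_{s,t}=1$, $\{n+2\}_{s,t}=s\{n+1\}_{s,t}+t\{n\}_{s,t}$ (so $\{2\}_{s,t}=s$). The generalized triangular numbers are $\genfrac{\{}{\}}{0pt}{}{m}{2}_{s,t}=\frac{\{m-1\}_{s,t}\{m\}_{s,t}}{\{2\}_{s,t}}$ for integers $m\geq1$. -}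

module Defs where

open import Data.Nat using (ℕ; zero; suc; _∸_)
open import Algebra.Bundles using (CommutativeRing)

-- Everything is parametrised by a commutative ring R (standing in for ℝ),
-- parameters s, t, and a chosen inverse s⁻¹ of s (division by s = * s⁻¹).
module GenFib {c ℓ} (R : CommutativeRing c ℓ) where
  open CommutativeRing R

  fib : Carrier → Carrier → ℕ → Carrier
  fib s t zero = 0#
  fib s t (suc zero) = 1#
  fib s t (suc (suc n)) = s * fib s t (suc n) + t * fib s t n

  -- generalized triangular number {m choose 2}_{s,t} = {m-1}{m} / {2},
  -- with {2} = s and division by s realised as multiplication by sinv.
  -- (Only used for m ≥ 1.)
  tri : (s t sinv : Carrier) → ℕ → Carrier
  tri s t sinv m = (fib s t (m ∸ 1) * fib s t m) * sinv

{-# OPTIONS --safe #-}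
-- With a = {n} and b = {n+1} we have {n+2} = s b + t a, so the two triangular
-- numbers are b (s b + t a)/s and a b/s. Their weighted difference of squares
-- factors as (b/s)² ((s b + t a)² − (t a)²) = (b/s)² · s b · (s b + 2 t a),
-- and cancelling one factor s leaves b³ ({n+2} + t {n})/s.
module Submission where

open import Defs
open import Level using (Level)
open import Data.Nat using (ℕ; suc; _≤_)
open import Relation.Nullary using (¬_)
open import Algebra.Bundles using (CommutativeRing)
import Algebra.Properties.Group as GroupProperties
import Algebra.Solver.Ring.NaturalCoefficients.Default as NaturalCoefficientsSolver
import Relation.Binary.Reasoning.Setoid as SetoidReasoning

module _ {c ℓ} (R : CommutativeRing c ℓ) where
  open CommutativeRing R
  open GenFib R
  open GroupProperties +-group using (//-rightDividesʳ)
  open NaturalCoefficientsSolver commutativeSemiring using (solve; _:*_; _:+_; _:=_)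
  open SetoidReasoning setoid

  triangular-square-split : ∀ a b s t u →
    (b * (s * b + t * a) * u) * (b * (s * b + t * a) * u)
    ≈ ((s * b + t * a) + t * a) * u * (b * b * b) * (s * u)
      + (t * t) * ((a * b * u) * (a * b * u))
  triangular-square-split = solve 5 (λ a b s t u →
    (b :* (s :* b :+ t :* a) :* u) :* (b :* (s :* b :+ t :* a) :* u)
    := ((s :* b :+ t :* a) :+ t :* a) :* u :* (b :* b :* b) :* (s :* u)
       :+ (t :* t) :* ((a :* b :* u) :* (a :* b :* u))) refl

  *-right-inverse-cancel : ∀ {s u} → s * u ≈ 1# → ∀ x → x * (s * u) ≈ x
  *-right-inverse-cancel {s} {u} su≈1 x = begin
    x * (s * u)  ≈⟨ *-congˡ su≈1 ⟩
    x * 1#       ≈⟨ *-identityʳ x ⟩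
    x            ∎

  tri-square-difference : ∀ s t u → s * u ≈ 1# → ∀ n →
    tri s t u (suc (suc n)) * tri s t u (suc (suc n))
      - (t * t) * (tri s t u (suc n) * tri s t u (suc n))
    ≈ ((fib s t (suc (suc n)) + t * fib s t n) * u)
      * (fib s t (suc n) * fib s t (suc n) * fib s t (suc n))
  tri-square-difference s t u su≈1 n = begin
    X² - T              ≈⟨ +-congʳ (triangular-square-split a b s t u) ⟩
    Y * (s * u) + T - T ≈⟨ //-rightDividesʳ T (Y * (s * u)) ⟩
    Y * (s * u)         ≈⟨ *-right-inverse-cancel su≈1 Y ⟩
    Y                   ∎
    where
    a = fib s t n
    b = fib s t (suc n)
    X² = tri s t u (suc (suc n)) * tri s t u (suc (suc n))
    T = (t * t) * (tri s t u (suc n) * tri s t u (suc n))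
    Y = ((s * b + t * a) + t * a) * u * (b * b * b)

-- The identity holds for every n and every t.
theorem3 : ∀ {c ℓ : Level} (R : CommutativeRing c ℓ) →
  let open CommutativeRing R
      open GenFib R
  in (s t sinv : Carrier) → s * sinv ≈ 1# → ¬ (t ≈ 0#) →
     (n : ℕ) → 1 ≤ n →
     tri s t sinv (suc (suc n)) * tri s t sinv (suc (suc n))
       - (t * t) * (tri s t sinv (suc n) * tri s t sinv (suc n))
     ≈ ((fib s t (suc (suc n)) + t * fib s t n) * sinv)
       * (fib s t (suc n) * fib s t (suc n) * fib s t (suc n))
theorem3 R s t sinv s*sinv≈1 _ n _ = tri-square-difference R s t sinv s*sinv≈1 n
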